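{- Let $n\geq 2$. For every $k\ge1$, $V_{2k,n}^-\in\mathcal{P}_n$. Moreover, if $k\leq\frac{n+1}{2}$, then $V_{2k,n}^-=2^{2k-1}P_{k-1,n}+\sum_{l<k-1}a_{k,l,n}P_{l,n}$ for some constants $a_{k,l,n}$. Hence $\{V_{2k,n}^-:1\leq k\leq\lfloor\frac{n+1}{2}\rfloor\}$ is a basis of $\mathcal{P}_n$.
   Context: A composition of $n$ is a sequence $I=(i_1,\dots,i_r)$ of positive integers summing to $n$; its descent set is $\{i_1,i_1+i_2,\dots,i_1+\dots+i_{r-1}\}$. Let $\mathbf{Sym}=\bigoplus_{n\ge0}\mathbf{Sym}_n$ be the algebra of noncommutative symmetric functions over $\mathbb{Q}$, with ribbon basis $R_I$ (and $R_\emptyset=1$ in degree $0$). Identify $\mathbf{Sym}_n$ with the descent algebra $\mathcal{D}_n\subseteq\mathbb{Q}[\mathfrak{S}_n]$ via $R_I\mapsto\sum\{\sigma:\mathrm{Des}(\sigma)=\text{descent set of }I\}$, where $\mathrm{Des}(\sigma)=\{i:\sigma(i)>\sigma(i+1)\}$. The external product $\star$ is $R_{(i_1,\dots,i_r)}\star R_{(j_1,\dots,j_s)}=R_{(i_1,\dots,i_r,j_1,\dots,j_s)}+R_{(i_1,\dots,i_{r-1},i_r+j_1,j_2,\dots,j_s)}$, extended to the completion $\widehat{\mathbf{Sym}}$ of formal sums of homogeneous elements. Let $V_1^+=\sum_{i\ge0}R_{(i)}$, $V_1^-=\sum_{i\ge0}R_{(1^i)}$, $V_{2k}^-=(V_1^-\star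 V_1^+)^{\star k}$, and let $V_{2k,n}^-$ be its degree-$n$ component. A peak of $\sigma\in\mathfrak{S}_n$ is $i$ with $2\le i\le n-1$ and $\sigma(i-1)<\sigma(i)>\sigma(i+1)$; $P_{l,n}$ is the sum of all $\sigma\in\mathfrak{S}_n$ with exactly $l$ peaks (zero if there are none), and $\mathcal{P}_n=\mathrm{span}\{P_{l,n}:0\le l\le\lfloor\frac{n-1}{2}\rfloor\}$ is the Eulerian peak algebra. -}

module Defs where

open import Data.Nat using (ℕ; zero; suc; _∸_; _<ᵇ_; _≡ᵇ_; _<?_; ⌊_/2⌋)
import Data.Nat as N
open import Data.Bool using (Bool; true; false; if_then_else_; _∧_; _∨_; not)
open import Data.List using (List; []; _∷_; _++_; [_]; map; concatMap; replicate; upTo; foldr)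
open import Data.Product using (Σ; _×_; _,_)
open import Data.Fin using (Fin; toℕ; fromℕ<)
open import Data.Fin.Permutation using (Permutation′; _⟨$⟩ʳ_)
open import Data.Rational using (ℚ; 0ℚ; 1ℚ; _+_; _*_)
open import Relation.Nullary using (yes; no)
open import Relation.Binary.PropositionalEquality using (_≡_)

-- Compositions are lists of positive naturals; R_I is represented by I.
-- A homogeneous element of Sym is a formal ℚ-linear combination of
-- ribbons: a list of (coefficient , composition) pairs.

Comp : Set
Comp = List ℕ

FSum : Set
FSum = List (ℚ × Comp)

mergeLast : Comp → ℕ → Comp
mergeLast []           j = j ∷ []
mergeLast (i ∷ [])     j = (i N.+ j) ∷ []
mergeLast (i ∷ i' ∷ I) j = i ∷ mergeLast (i' ∷ I) j

ribbonStar : Comp → Comp → List Comp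
ribbonStar []          J       = J ∷ []
ribbonStar (i ∷ I)     []      = (i ∷ I) ∷ []
ribbonStar (i ∷ I)     (j ∷ J) = ((i ∷ I) ++ (j ∷ J)) ∷ (mergeLast (i ∷ I) j ++ J) ∷ []

star : FSum → FSum → FSum
star X Y = concatMap (λ { (c , I) → concatMap (λ { (d , J) →
             map (λ K → (c * d , K)) (ribbonStar I J) }) Y }) X

-- Elements of the completion, given by their homogeneous components
Graded : Set
Graded = ℕ → FSum

conv : Graded → Graded → Graded
conv X Y n = concatMap (λ a → star (X a) (Y (n ∸ a))) (upTo (suc n))

unitG : Graded
unitG zero    = (1ℚ , []) ∷ []
unitG (suc _) = []

V1plus : Graded
V1plus zero    = (1ℚ , []) ∷ []
V1plus (suc d) = (1ℚ , suc d ∷ []) ∷ []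

V1minus : Graded
V1minus d = (1ℚ , replicate d 1) ∷ []

Vpow : ℕ → Graded
Vpow zero    = unitG
Vpow (suc k) = conv (conv V1minus V1plus) (Vpow k)

-- V⁻_{2k,n} : degree-n component of V⁻_{2k}
Vminus : ℕ → ℕ → FSum
Vminus k n = Vpow k n

descsFrom : ℕ → Comp → List ℕ
descsFrom acc []           = []
descsFrom acc (i ∷ [])     = []
descsFrom acc (i ∷ i' ∷ I) = (acc N.+ i) ∷ descsFrom (acc N.+ i) (i' ∷ I)

compDes : Comp → List ℕ
compDes = descsFrom 0

anyB : (ℕ → Bool) → List ℕ → Bool
anyB p []       = false
anyB p (x ∷ xs) = p x ∨ anyB p xs

allB : (ℕ → Bool) → List ℕ → Bool
allB p []       = true
allB p (x ∷ xs) = p x ∧ allB p xs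

memb : ℕ → List ℕ → Bool
memb i xs = anyB (λ m → m ≡ᵇ i) xs

-- σ(i) with 1-indexed position i (1 ≤ i ≤ n); 0 outside the range
val : ∀ {n} → Permutation′ n → ℕ → ℕ
val {n} σ zero = 0
val {n} σ (suc p) with p <? n
... | yes p<n = toℕ (σ ⟨$⟩ʳ fromℕ< p<n)
... | no _    = 0

isDes : ∀ {n} → Permutation′ n → ℕ → Bool
isDes σ i = val σ (suc i) <ᵇ val σ i

range : ℕ → ℕ → List ℕ
range a zero    = []
range a (suc m) = a ∷ range (suc a) m

boolEq : Bool → Bool → Bool
boolEq true  b = b
boolEq false b = not b

sameDes : ∀ {n} → Permutation′ n → Comp → Bool
sameDes {n} σ I = allB (λ i → boolEq (isDes σ i) (memb i (compDes I))) (range 1 (n ∸ 1))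
                ∧ allB (λ d → (0 <ᵇ d) ∧ (d <ᵇ n)) (compDes I)

-- The group algebra ℚ[𝔖ₙ] : coefficient functions on permutations

QS : ℕ → Set
QS n = Permutation′ n → ℚ

-- identification Symₙ ≅ 𝒟ₙ ⊆ ℚ[𝔖ₙ] :  R_I ↦ Σ {σ : Des σ = Des I}
ι : (n : ℕ) → FSum → QS n
ι n X σ = foldr (λ { (c , I) acc → (if sameDes σ I then c else 0ℚ) + acc }) 0ℚ X

isPeak : ∀ {n} → Permutation′ n → ℕ → Bool
isPeak σ i = (val σ (i ∸ 1) <ᵇ val σ i) ∧ (val σ (suc i) <ᵇ val σ i)

count : (ℕ → Bool) → List ℕ → ℕ
count p []       = 0
count p (x ∷ xs) = if p x then suc (count p xs) else count p xs

peaks : ∀ {n} → Permutation′ n → ℕ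
peaks {n} σ = count (isPeak σ) (range 2 (n ∸ 2))

Ppk : (n l : ℕ) → QS n
Ppk n l σ = if peaks σ ≡ᵇ l then 1ℚ else 0ℚ

sumTo : ℕ → (ℕ → ℚ) → ℚ
sumTo zero    f = 0ℚ
sumTo (suc m) f = sumTo m f + f m

pow2 : ℕ → ℚ
pow2 zero    = 1ℚ
pow2 (suc e) = (1ℚ + 1ℚ) * pow2 e

InPeakAlg : (n : ℕ) → QS n → Set
InPeakAlg n f = Σ (ℕ → ℚ) λ a →
  ∀ σ → f σ ≡ sumTo (suc ⌊ n ∸ 1 /2⌋) (λ l → a l * Ppk n l σ)

-- the family j ↦ V⁻_{2(j+1),n}, j < ⌊(n+1)/2⌋, is a basis of 𝒫ₙ
IsPeakBasis : (n : ℕ) → Set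
IsPeakBasis n =
  ((f : QS n) → InPeakAlg n f → Σ (ℕ → ℚ) λ c →
     ∀ σ → f σ ≡ sumTo ⌊ suc n /2⌋ (λ j → c j * ι n (Vminus (suc j) n) σ))
  ×
  ((c : ℕ → ℚ) →
     (∀ σ → sumTo ⌊ suc n /2⌋ (λ j → c j * ι n (Vminus (suc j) n) σ) ≡ 0ℚ) →
     ∀ j → j N.< ⌊ suc n /2⌋ → c j ≡ 0ℚ)

{-# OPTIONS --safe #-}
-- A ribbon R_I of degree n is recorded by the word of length n − 1 marking its descent set, so ι sends an
-- element of Sym_n to the function σ ↦ (its coefficient at the descent word of σ). The coefficient of V₁⁻ ⋆ V₁⁺
-- is 2 on peakless words and 0 elsewhere, so multiplying by it turns a coefficient function s into
-- s + increment s. By induction on k, the coefficients of V⁻₂ₖ depend only on the length and the number of peaks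
-- of the word (this needs the auxiliary relation PeakLaw), vanish on words with at least k peaks and equal
-- 2^(2k−1) on words with k − 1 peaks. Hence V⁻₂ₖ,ₙ = Σ_l a_l P_l,n with a triangular coefficient matrix whose
-- diagonal is invertible; together with a permutation with any number l ≤ (n − 1)/2 of peaks this gives the
-- leading term and, by back-substitution, the basis.
module Submission where

open import Defs
open import Data.Nat using (ℕ; zero; suc; _+_; _*_; _∸_; _≤_; _<_; z≤n; s≤s; _≡ᵇ_; _<ᵇ_; _<?_; ⌊_/2⌋)
open import Data.Nat.Properties
  using (+-suc; +-comm; +-assoc; +-identityʳ; suc-injective; ≤-refl; ≤-reflexive; ≤-trans; ≤-pred; <-trans;
         <-≤-trans; <⇒≤; <⇒≢; <⇒<ᵇ; n≤1+n; n<1+n; 1+n≰n; m≤m+n; m<m+n; m<n⇒m<1+n; m≤n⇒m<n∨m≡n; +-mono-≤;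
         +-monoʳ-<; m∸n+n≡m; m+[n∸m]≡n; m+n∸m≡n; n∸n≡0; n≡⌊n+n/2⌋; ⌊n/2⌋-mono; ⌊n/2⌋≤⌈n/2⌉; ⌊n/2⌋+⌈n/2⌉≡n)
open import Data.Nat.ListAction using (sum)
open import Data.Nat.ListAction.Properties using (sum-++)
open import Data.Nat.Tactic.RingSolver using (solve-∀)
open import Data.Bool using (Bool; true; false; if_then_else_; _∧_; _∨_; not)
open import Data.Bool.Properties using (∧-assoc; ∧-zeroʳ; ∧-identityʳ; T-≡)
open import Data.Bool.ListAction using (and; all)
open import Data.List using (List; []; _∷_; _++_; length; replicate; map; concatMap; applyUpTo; upTo)
open import Data.List.Properties
  using (++-assoc; ++-identityʳ; length-++; length-replicate; length-map; map-cong; map-cong-local)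
open import Data.List.Relation.Unary.All as All using (All; []; _∷_; universal-U)
open import Data.List.Relation.Unary.All.Properties using (++⁺; concat⁺; map⁺; applyUpTo⁺₁)
open import Data.Product using (Σ; _×_; _,_; proj₁; proj₂)
open import Data.Sum using (inj₁; inj₂)
open import Data.Empty using (⊥; ⊥-elim)
open import Data.Rational using (ℚ; 0ℚ; 1ℚ; ½)
import Data.Rational as Q
import Data.Rational.Properties as Q
open import Data.Rational.Solver using (module +-*-Solver)
open +-*-Solver using (solve; _:+_; _:*_; _:-_; _:=_; con)
open import Data.Fin using (Fin; toℕ; fromℕ<)
open import Data.Fin.Properties using (toℕ-fromℕ<; toℕ-injective; toℕ<n)
open import Data.Fin.Permutation using (Permutation′; permutation; _⟨$⟩ʳ_; _⟨$⟩ˡ_; inverseˡ)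
open import Algebra.Bundles using (CommutativeMonoid)
open import Algebra.Properties.CommutativeSemigroup
  (CommutativeMonoid.commutativeSemigroup Q.+-0-commutativeMonoid) using (interchange)
open import Function using (id; _∘_)
open import Function.Bundles using (Equivalence)
open import Relation.Unary using (U)
open import Relation.Nullary using (yes; no)
open import Relation.Binary.PropositionalEquality

-- Descent words and their peaks

-- Letter i of a descent word is true iff i is a descent, so i is a peak iff letters i − 1, i are false, true.
peakCount : List Bool → ℕ
peakCount []          = 0
peakCount (_ ∷ [])    = 0
peakCount (x ∷ y ∷ w) = if not x ∧ y then suc (peakCount (y ∷ w)) else peakCount (y ∷ w)

peakCount-true∷ : ∀ w → peakCount (true ∷ w) ≡ peakCount w
peakCount-true∷ []      = refl
peakCount-true∷ (_ ∷ _) = refl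

peakCount+peakCount≤length : ∀ u → peakCount u + peakCount u ≤ length u
peakCount+peakCount≤length []                  = z≤n
peakCount+peakCount≤length (_ ∷ [])            = z≤n
peakCount+peakCount≤length (true ∷ y ∷ w)      = ≤-trans (peakCount+peakCount≤length (y ∷ w)) (n≤1+n _)
peakCount+peakCount≤length (false ∷ false ∷ w) = ≤-trans (peakCount+peakCount≤length (false ∷ w)) (n≤1+n _)
peakCount+peakCount≤length (false ∷ true ∷ w)
  rewrite peakCount-true∷ w | +-suc (peakCount w) (peakCount w) = s≤s (s≤s (peakCount+peakCount≤length w))

zigzag : ℕ → List Bool
zigzag zero    = []
zigzag (suc p) = false ∷ true ∷ zigzag p

normalWord : ℕ → ℕ → List Bool
normalWord a p = replicate a true ++ zigzag p

length-zigzag : ∀ p → length (zigzag p) ≡ p + p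
length-zigzag zero    = refl
length-zigzag (suc p) = cong suc (trans (cong suc (length-zigzag p)) (sym (+-suc p p)))

length-normalWord : ∀ a p → length (normalWord a p) ≡ a + (p + p)
length-normalWord a p =
  trans (length-++ (replicate a true)) (cong₂ _+_ (length-replicate a) (length-zigzag p))

peakCount-normalWord : ∀ a p → peakCount (normalWord a p) ≡ p
peakCount-normalWord zero    zero    = refl
peakCount-normalWord zero    (suc p) = cong suc (trans (peakCount-true∷ (zigzag p)) (peakCount-normalWord zero p))
peakCount-normalWord (suc a) p       = trans (peakCount-true∷ (normalWord a p)) (peakCount-normalWord a p)

two : ℚ
two = 1ℚ Q.+ 1ℚ

-- increment s u is the coefficient of u in (V₁⁻ ⋆ V₁⁺ − 1) ⋆ X when X has coefficient s v at every word v of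
-- positive degree and 1 in degree 0 (cutSum-peakless).
increment : (List Bool → ℚ) → List Bool → ℚ
increment s []                  = two
increment s (true ∷ w)          = two Q.* s w Q.+ increment s w
increment s (false ∷ [])        = two Q.* s [] Q.+ increment s []
increment s (false ∷ true ∷ w)  = two Q.* s (true ∷ w) Q.+ two Q.* s w
increment s (false ∷ false ∷ w) = two Q.* s (false ∷ w) Q.+ increment s (false ∷ w)

PeakInvariant : (List Bool → ℚ) → Set
PeakInvariant s = ∀ u v → length u ≡ length v → peakCount u ≡ peakCount v → s u ≡ s v

-- Not implied by PeakInvariant, but needed for increment to preserve it (increment-zigzag).
PeakLaw : (List Bool → ℚ) → Set
PeakLaw s = ∀ v → s (false ∷ true ∷ v) Q.+ s v ≡ s (true ∷ true ∷ v)

module _ {s : List Bool → ℚ} (inv : PeakInvariant s) (law : PeakLaw s) where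

  private
    s-normal : ∀ u a p → length u ≡ a + (p + p) → peakCount u ≡ p → s u ≡ s (normalWord a p)
    s-normal u a p ℓ π =
      inv u (normalWord a p) (trans ℓ (sym (length-normalWord a p))) (trans π (sym (peakCount-normalWord a p)))

    length-zigzag-step : ∀ a q → suc (suc (a + (q + q))) ≡ a + (suc q + suc q)
    length-zigzag-step = solve-∀

  increment-zigzag : ∀ a q → increment s (normalWord a (suc q)) ≡ increment s (false ∷ true ∷ normalWord a q)
  increment-zigzag zero    q = refl
  increment-zigzag (suc a) q = begin
    two Q.* s (normalWord a (suc q)) Q.+ increment s (normalWord a (suc q))
      ≡⟨ cong₂ (λ x y → two Q.* x Q.+ y) (sym (s-normal (false ∷ true ∷ v) a (suc q) ℓ π)) (increment-zigzag a q) ⟩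
    two Q.* s (false ∷ true ∷ v) Q.+ (two Q.* s (true ∷ v) Q.+ two Q.* s v)
      ≡⟨ solve 4 (λ t x y z → t :* x :+ (t :* y :+ t :* z) := t :* (x :+ z) :+ t :* y) refl
               two (s (false ∷ true ∷ v)) (s (true ∷ v)) (s v) ⟩
    two Q.* (s (false ∷ true ∷ v) Q.+ s v) Q.+ two Q.* s (true ∷ v)
      ≡⟨ cong (λ x → two Q.* x Q.+ two Q.* s (true ∷ v)) (law v) ⟩
    two Q.* s (true ∷ true ∷ v) Q.+ two Q.* s (true ∷ v) ∎
    where
    open ≡-Reasoning
    v = normalWord a q
    ℓ : length (false ∷ true ∷ v) ≡ a + (suc q + suc q)
    ℓ = trans (cong (λ m → suc (suc m)) (length-normalWord a q)) (length-zigzag-step a q)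
    π : peakCount (false ∷ true ∷ v) ≡ suc q
    π = cong suc (trans (peakCount-true∷ v) (peakCount-normalWord a q))

  private
    no-room : ∀ w p → suc (length w) ≡ p + p → peakCount w ≡ p → ⊥
    no-room w p ℓ refl = 1+n≰n (subst (_≤ length w) (sym ℓ) (peakCount+peakCount≤length w))

    peel : ∀ w a p → length w ≡ a + (p + p) → peakCount w ≡ p
         → increment s w ≡ increment s (normalWord a p)
         → two Q.* s w Q.+ increment s w ≡ increment s (normalWord (suc a) p)
    peel w a p ℓ π = cong₂ (λ x y → two Q.* x Q.+ y) (s-normal w a p ℓ π)

  increment-normal : ∀ u a p → length u ≡ a + (p + p) → peakCount u ≡ p
                   → increment s u ≡ increment s (normalWord a p)
  increment-normal []                  zero    zero    _ _ = refl
  increment-normal []                  (suc a) _       () _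
  increment-normal []                  zero    (suc p) _ ()
  increment-normal (true ∷ w)          zero    p ℓ π = ⊥-elim (no-room w p ℓ (trans (sym (peakCount-true∷ w)) π))
  increment-normal (true ∷ w)          (suc a) p ℓ π =
    peel w a p ℓ′ π′ (increment-normal w a p ℓ′ π′)
    where
    ℓ′ = suc-injective ℓ
    π′ = trans (sym (peakCount-true∷ w)) π
  increment-normal (false ∷ [])        (suc a) .0 ℓ refl = peel [] a 0 ℓ′ refl (increment-normal [] a 0 ℓ′ refl)
    where ℓ′ = suc-injective ℓ
  increment-normal (false ∷ false ∷ w) zero    p ℓ π = ⊥-elim (no-room (false ∷ w) p ℓ π)
  increment-normal (false ∷ false ∷ w) (suc a) p ℓ π =
    peel (false ∷ w) a p ℓ′ π (increment-normal (false ∷ w) a p ℓ′ π)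
    where ℓ′ = suc-injective ℓ
  increment-normal (false ∷ true ∷ w)  a (suc q) ℓ π = begin
    two Q.* s (true ∷ w) Q.+ two Q.* s w
      ≡⟨ cong₂ (λ x y → two Q.* x Q.+ two Q.* y)
               (s-normal (true ∷ w) (suc a) q (cong suc ℓ′) (trans (peakCount-true∷ w) π′))
               (s-normal w a q ℓ′ π′) ⟩
    increment s (false ∷ true ∷ normalWord a q)
      ≡⟨ sym (increment-zigzag a q) ⟩
    increment s (normalWord a (suc q)) ∎
    where
    open ≡-Reasoning
    ℓ′ : length w ≡ a + (q + q)
    ℓ′ = suc-injective (suc-injective (trans ℓ (sym (length-zigzag-step a q))))
    π′ : peakCount w ≡ q
    π′ = trans (sym (peakCount-true∷ w)) (suc-injective π)

  increment-invariant : PeakInvariant (increment s)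
  increment-invariant u v ℓ π =
    trans (increment-normal u a p ℓᵤ refl) (sym (increment-normal v a p (trans (sym ℓ) ℓᵤ) (sym π)))
    where
    p = peakCount u
    a = length u ∸ (p + p)
    ℓᵤ : length u ≡ a + (p + p)
    ℓᵤ = sym (m∸n+n≡m (peakCount+peakCount≤length u))

increment-peakLaw : ∀ s → PeakLaw (increment s)
increment-peakLaw s v = Q.+-assoc (two Q.* s (true ∷ v)) (two Q.* s v) (increment s v)

-- The coefficient in V⁻₂ₖ of the ribbon with descent word u (coeffG-Vpow).
coeffV : ℕ → List Bool → ℚ
coeffV zero    u = 0ℚ
coeffV (suc k) u = coeffV k u Q.+ increment (coeffV k) u

coeffV-peakLaw : ∀ k → PeakLaw (coeffV k)
coeffV-peakLaw zero    v = refl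
coeffV-peakLaw (suc k) v =
  trans (interchange (s (false ∷ true ∷ v)) (increment s (false ∷ true ∷ v)) (s v) (increment s v))
        (cong₂ Q._+_ (coeffV-peakLaw k v) (increment-peakLaw s v))
  where s = coeffV k

coeffV-invariant : ∀ k → PeakInvariant (coeffV k)
coeffV-invariant zero    u v ℓ π = refl
coeffV-invariant (suc k) u v ℓ π =
  cong₂ Q._+_ (coeffV-invariant k u v ℓ π)
              (increment-invariant (coeffV-invariant k) (coeffV-peakLaw k) u v ℓ π)

private
  peel-null : ∀ {x y z} → x ≡ 0ℚ → y ≡ z → two Q.* x Q.+ y ≡ z
  peel-null refl refl = Q.+-identityˡ _

increment-vanishes : ∀ {s} k → (∀ u → k ≤ peakCount u → s u ≡ 0ℚ)
                   → ∀ u → suc k ≤ peakCount u → increment s u ≡ 0ℚ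
increment-vanishes k s≡0 (true ∷ w) le =
  peel-null (s≡0 w (≤-trans (n≤1+n k) le′)) (increment-vanishes k s≡0 w le′)
  where le′ = subst (suc k ≤_) (peakCount-true∷ w) le
increment-vanishes k s≡0 (false ∷ false ∷ w) le =
  peel-null (s≡0 (false ∷ w) (≤-trans (n≤1+n k) le)) (increment-vanishes k s≡0 (false ∷ w) le)
increment-vanishes k s≡0 (false ∷ true ∷ w) (s≤s le) =
  peel-null (s≡0 (true ∷ w) le) (cong (two Q.*_) (s≡0 w (subst (k ≤_) (peakCount-true∷ w) le)))

coeffV-vanishes : ∀ k u → k ≤ peakCount u → coeffV k u ≡ 0ℚ
coeffV-vanishes zero    u _  = refl
coeffV-vanishes (suc k) u le =
  cong₂ Q._+_ (coeffV-vanishes k u (≤-trans (n≤1+n k) le)) (increment-vanishes k (coeffV-vanishes k) u le)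

increment-peakless : ∀ {s} → (∀ u → s u ≡ 0ℚ) → ∀ u → peakCount u ≡ 0 → increment s u ≡ pow2 1
increment-peakless s≡0 []                  _ = refl
increment-peakless s≡0 (false ∷ [])        _ = peel-null (s≡0 []) refl
increment-peakless s≡0 (true ∷ w)          π =
  peel-null (s≡0 w) (increment-peakless s≡0 w (trans (sym (peakCount-true∷ w)) π))
increment-peakless s≡0 (false ∷ false ∷ w) π = peel-null (s≡0 (false ∷ w)) (increment-peakless s≡0 (false ∷ w) π)

increment-leading : ∀ {s} k → (∀ u → suc k ≤ peakCount u → s u ≡ 0ℚ)
                  → (∀ u → peakCount u ≡ k → s u ≡ pow2 (suc (k + k)))
                  → ∀ u → peakCount u ≡ suc k → increment s u ≡ pow2 (suc (suc k + suc k))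
increment-leading k s≡0 lead (true ∷ w) π =
  peel-null (s≡0 w (≤-reflexive (sym π′))) (increment-leading k s≡0 lead w π′)
  where π′ = trans (sym (peakCount-true∷ w)) π
increment-leading k s≡0 lead (false ∷ false ∷ w) π =
  peel-null (s≡0 (false ∷ w) (≤-reflexive (sym π))) (increment-leading k s≡0 lead (false ∷ w) π)
increment-leading {s} k s≡0 lead (false ∷ true ∷ w) π = begin
  two Q.* s (true ∷ w) Q.+ two Q.* s w
    ≡⟨ cong₂ (λ x y → two Q.* x Q.+ two Q.* y)
             (lead (true ∷ w) (suc-injective π)) (lead w (trans (sym (peakCount-true∷ w)) (suc-injective π))) ⟩
  two Q.* c Q.+ two Q.* c
    ≡⟨ solve 1 (λ x → con two :* x :+ con two :* x := con two :* (con two :* x)) refl c ⟩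
  two Q.* (two Q.* c)
    ≡⟨ cong (λ m → pow2 (suc (suc m))) (sym (+-suc k k)) ⟩
  pow2 (suc (suc k + suc k)) ∎
  where
  open ≡-Reasoning
  c = pow2 (suc (k + k))

coeffV-leading : ∀ k u → peakCount u ≡ k → coeffV (suc k) u ≡ pow2 (suc (k + k))
coeffV-leading zero    u π = trans (Q.+-identityˡ _) (increment-peakless (λ _ → refl) u π)
coeffV-leading (suc k) u π =
  trans (cong (Q._+ increment (coeffV (suc k)) u) (coeffV-vanishes (suc k) u (≤-reflexive (sym π))))
        (trans (Q.+-identityˡ _) (increment-leading k (coeffV-vanishes (suc k)) (coeffV-leading k) u π))

-- Coefficients of ribbons

∑ : {A : Set} → (A → ℚ) → List A → ℚ
∑ f []       = 0ℚ
∑ f (x ∷ xs) = f x Q.+ ∑ f xs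

∑-++ : {A : Set} (f : A → ℚ) (xs ys : List A) → ∑ f (xs ++ ys) ≡ ∑ f xs Q.+ ∑ f ys
∑-++ f []       ys = sym (Q.+-identityˡ (∑ f ys))
∑-++ f (x ∷ xs) ys = trans (cong (f x Q.+_) (∑-++ f xs ys)) (sym (Q.+-assoc (f x) (∑ f xs) (∑ f ys)))

∑-cong : {A : Set} {f g : A → ℚ} (xs : List A) → (∀ x → f x ≡ g x) → ∑ f xs ≡ ∑ g xs
∑-cong []       eq = refl
∑-cong (x ∷ xs) eq = cong₂ Q._+_ (eq x) (∑-cong xs eq)

∑-congᴬ : {A : Set} {P : A → Set} {f g : A → ℚ} {xs : List A}
        → All P xs → (∀ {x} → P x → f x ≡ g x) → ∑ f xs ≡ ∑ g xs
∑-congᴬ []         _  = refl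
∑-congᴬ (px ∷ pxs) eq = cong₂ Q._+_ (eq px) (∑-congᴬ pxs eq)

∑-*ˡ : {A : Set} (c : ℚ) (f : A → ℚ) (xs : List A) → ∑ (λ x → c Q.* f x) xs ≡ c Q.* ∑ f xs
∑-*ˡ c f []       = sym (Q.*-zeroʳ c)
∑-*ˡ c f (x ∷ xs) = trans (cong (c Q.* f x Q.+_) (∑-*ˡ c f xs)) (sym (Q.*-distribˡ-+ c (f x) (∑ f xs)))

∑-bilinear : {A B : Set} {P : A → Set} {R : B → Set} {xs : List A} {ys : List B}
             (H : A → B → ℚ) (f : A → ℚ) (g : B → ℚ) → All P xs → All R ys
           → (∀ x y → P x → R y → H x y ≡ f x Q.* g y)
           → ∑ (λ x → ∑ (H x) ys) xs ≡ ∑ f xs Q.* ∑ g ys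
∑-bilinear {ys = ys} H f g []         _   _  = sym (Q.*-zeroˡ (∑ g ys))
∑-bilinear {xs = x ∷ xs} {ys} H f g (px ∷ pxs) pys eq =
  trans (cong₂ Q._+_ (trans (∑-congᴬ pys (eq x _ px)) (∑-*ˡ (f x) g ys)) (∑-bilinear H f g pxs pys eq))
        (sym (Q.*-distribʳ-+ (∑ g ys) (f x) (∑ f xs)))

ribbonWord : Comp → List Bool
ribbonWord []          = []
ribbonWord (i ∷ [])    = replicate (i ∸ 1) false
ribbonWord (i ∷ j ∷ J) = replicate (i ∸ 1) false ++ true ∷ ribbonWord (j ∷ J)

wordEq : List Bool → List Bool → Bool
wordEq []       []       = true
wordEq []       (_ ∷ _)  = false
wordEq (_ ∷ _)  []       = false
wordEq (x ∷ xs) (y ∷ ys) = boolEq x y ∧ wordEq xs ys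

select : Bool → ℚ → ℚ
select b c = if b then c else 0ℚ

coeffOf : List Bool → ℚ × Comp → ℚ
coeffOf u (c , I) = select (wordEq u (ribbonWord I)) c

coeff : FSum → List Bool → ℚ
coeff X u = ∑ (coeffOf u) X

coeff-concatMap : {A : Set} (G : A → FSum) (xs : List A) (u : List Bool)
                → coeff (concatMap G xs) u ≡ ∑ (λ a → coeff (G a) u) xs
coeff-concatMap G []       u = refl
coeff-concatMap G (x ∷ xs) u =
  trans (∑-++ (coeffOf u) (G x) (concatMap G xs)) (cong (coeff (G x) u Q.+_) (coeff-concatMap G xs u))

ribbonTerms : ℚ × Comp → ℚ × Comp → FSum
ribbonTerms (c , I) (d , J) = map (c Q.* d ,_) (ribbonStar I J)

coeff-star : ∀ X Y u → coeff (star X Y) u ≡ ∑ (λ e → ∑ (λ e′ → coeff (ribbonTerms e e′) u) Y) X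
coeff-star X Y u =
  trans (coeff-concatMap (λ e → concatMap (ribbonTerms e) Y) X u)
        (∑-cong X (λ e → coeff-concatMap (ribbonTerms e) Y u))

IsComposition : ℕ → Comp → Set
IsComposition d I = sum I ≡ d × All (1 ≤_) I

-- FSum allows arbitrary lists of naturals; only compositions with positive parts are determined by their words.
Homogeneous : ℕ → FSum → Set
Homogeneous d X = All (λ e → IsComposition d (proj₂ e)) X

composition-zero : ∀ {I} → IsComposition 0 I → I ≡ []
composition-zero {[]}          _              = refl
composition-zero {suc _ ∷ _}   (() , _)
composition-zero {zero ∷ _}    (_ , () ∷ _)

private
  length-ribbonWord-positive : ∀ {I} → All (1 ≤_) I → length (ribbonWord I) ≡ sum I ∸ 1
  length-ribbonWord-positive {[]}                _                 = refl
  length-ribbonWord-positive {i ∷ []}            _                 =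
    trans (length-replicate (i ∸ 1)) (cong (_∸ 1) (sym (+-identityʳ i)))
  length-ribbonWord-positive {suc i ∷ suc j ∷ J} (_ ∷ pos@(_ ∷ _)) =
    trans (length-++ (replicate i false))
          (cong₂ (λ a b → a + suc b) (length-replicate i) (length-ribbonWord-positive pos))

length-ribbonWord : ∀ {d I} → IsComposition (suc d) I → length (ribbonWord I) ≡ d
length-ribbonWord (ΣI , pos) = trans (length-ribbonWord-positive pos) (cong (_∸ 1) ΣI)

private
  replicate-+-suc : ∀ i j (R : List Bool)
                  → replicate (i + suc j) false ++ R ≡ replicate i false ++ false ∷ replicate j false ++ R
  replicate-+-suc zero    j R = refl
  replicate-+-suc (suc i) j R = cong (false ∷_) (replicate-+-suc i j R)

  prefix-++ : ∀ (p : List Bool) {a b c} → a ≡ b ++ c → p ++ a ≡ (p ++ b) ++ c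
  prefix-++ p {b = b} {c} eq = trans (cong (p ++_) eq) (sym (++-assoc p b c))

ribbonWord-++ : ∀ i I j J → ribbonWord ((i ∷ I) ++ (j ∷ J)) ≡ ribbonWord (i ∷ I) ++ true ∷ ribbonWord (j ∷ J)
ribbonWord-++ i []       j J = refl
ribbonWord-++ i (i′ ∷ I) j J = prefix-++ (replicate (i ∸ 1) false) (cong (true ∷_) (ribbonWord-++ i′ I j J))

ribbonWord-mergeLast : ∀ i I j J → All (1 ≤_) (i ∷ I) → 1 ≤ j
                     → ribbonWord (mergeLast (i ∷ I) j ++ J) ≡ ribbonWord (i ∷ I) ++ false ∷ ribbonWord (j ∷ J)
ribbonWord-mergeLast (suc i) []           (suc j) []       _ _ =
  trans (sym (++-identityʳ _))
        (trans (replicate-+-suc i j []) (cong (λ z → replicate i false ++ false ∷ z) (++-identityʳ _)))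
ribbonWord-mergeLast (suc i) []           (suc j) (j′ ∷ J) _ _ = replicate-+-suc i j (true ∷ ribbonWord (j′ ∷ J))
ribbonWord-mergeLast i       (i′ ∷ [])     j J (_ ∷ pos) pj =
  prefix-++ (replicate (i ∸ 1) false) (cong (true ∷_) (ribbonWord-mergeLast i′ [] j J pos pj))
ribbonWord-mergeLast i       (i′ ∷ i″ ∷ I) j J (_ ∷ pos) pj =
  prefix-++ (replicate (i ∸ 1) false) (cong (true ∷_) (ribbonWord-mergeLast i′ (i″ ∷ I) j J pos pj))

wordEq-++ : ∀ v p x y w q → length v ≡ length p
          → wordEq (v ++ x ∷ w) (p ++ y ∷ q) ≡ wordEq v p ∧ (boolEq x y ∧ wordEq w q)
wordEq-++ []      []      x y w q _  = refl
wordEq-++ (a ∷ v) (b ∷ p) x y w q eq =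
  trans (cong (boolEq a b ∧_) (wordEq-++ v p x y w q (suc-injective eq))) (sym (∧-assoc (boolEq a b) (wordEq v p) _))

private
  select-*ˡ : ∀ b c d → select b (c Q.* d) Q.+ 0ℚ ≡ c Q.* select b d
  select-*ˡ true  c d = Q.+-identityʳ (c Q.* d)
  select-*ˡ false c d = sym (Q.*-zeroʳ c)

  select-*ʳ : ∀ b c d → select b (c Q.* d) Q.+ 0ℚ ≡ select b c Q.* d
  select-*ʳ true  c d = Q.+-identityʳ (c Q.* d)
  select-*ʳ false c d = sym (Q.*-zeroˡ d)

  -- Exactly one of the two ribbons of R_I ⋆ R_J has the letter x at the junction.
  select-junction : ∀ a x b c d
                  → select (a ∧ (boolEq x true ∧ b)) (c Q.* d) Q.+ (select (a ∧ (boolEq x false ∧ b)) (c Q.* d) Q.+ 0ℚ)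
                    ≡ select a c Q.* select b d
  select-junction false x     b     c d = sym (Q.*-zeroˡ (select b d))
  select-junction true  true  true  c d = Q.+-identityʳ (c Q.* d)
  select-junction true  false true  c d = trans (Q.+-identityˡ _) (Q.+-identityʳ (c Q.* d))
  select-junction true  x     false c d rewrite ∧-zeroʳ (boolEq x true) | ∧-zeroʳ (boolEq x false) = sym (Q.*-zeroʳ c)

coeff-star-unitˡ : ∀ X Y u → Homogeneous 0 X → coeff (star X Y) u ≡ coeff X [] Q.* coeff Y u
coeff-star-unitˡ X Y u hX = trans (coeff-star X Y u) (∑-bilinear _ (coeffOf []) (coeffOf u) hX (universal-U Y) pair)
  where
  pair : ∀ e e′ → IsComposition 0 (proj₂ e) → U e′ → coeff (ribbonTerms e e′) u ≡ coeffOf [] e Q.* coeffOf u e′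
  pair (c , I) (d , J) isC _ rewrite composition-zero isC = select-*ˡ (wordEq u (ribbonWord J)) c d

coeff-star-unitʳ : ∀ X Y u → Homogeneous 0 Y → coeff (star X Y) u ≡ coeff X u Q.* coeff Y []
coeff-star-unitʳ X Y u hY = trans (coeff-star X Y u) (∑-bilinear _ (coeffOf u) (coeffOf []) (universal-U X) hY pair)
  where
  pair : ∀ e e′ → U e → IsComposition 0 (proj₂ e′) → coeff (ribbonTerms e e′) u ≡ coeffOf u e Q.* coeffOf [] e′
  pair (c , [])    (d , J) _ isC rewrite composition-zero isC = select-*ʳ (wordEq u []) c d
  pair (c , i ∷ I) (d , J) _ isC rewrite composition-zero isC = select-*ʳ (wordEq u (ribbonWord (i ∷ I))) c d

coeff-star-split : ∀ X Y v x w → Homogeneous (suc (length v)) X → Homogeneous (suc (length w)) Y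
                 → coeff (star X Y) (v ++ x ∷ w) ≡ coeff X v Q.* coeff Y w
coeff-star-split X Y v x w hX hY =
  trans (coeff-star X Y (v ++ x ∷ w)) (∑-bilinear _ (coeffOf v) (coeffOf w) hX hY pair)
  where
  pair : ∀ e e′ → IsComposition (suc (length v)) (proj₂ e) → IsComposition (suc (length w)) (proj₂ e′)
       → coeff (ribbonTerms e e′) (v ++ x ∷ w) ≡ coeffOf v e Q.* coeffOf w e′
  pair (c , i ∷ I) (d , j ∷ J) (ΣI , posI) (_ , posJ@(pj ∷ _))
    rewrite ribbonWord-++ i I j J | ribbonWord-mergeLast i I j J posI pj
          | wordEq-++ v (ribbonWord (i ∷ I)) x true  w (ribbonWord (j ∷ J)) (sym (length-ribbonWord (ΣI , posI)))
          | wordEq-++ v (ribbonWord (i ∷ I)) x false w (ribbonWord (j ∷ J)) (sym (length-ribbonWord (ΣI , posI))) =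
    select-junction (wordEq v (ribbonWord (i ∷ I))) x (wordEq w (ribbonWord (j ∷ J))) c d

sum-mergeLast : ∀ i I j → sum (mergeLast (i ∷ I) j) ≡ sum (i ∷ I) + j
sum-mergeLast i []       j = trans (+-identityʳ (i + j)) (cong (_+ j) (sym (+-identityʳ i)))
sum-mergeLast i (i′ ∷ I) j = trans (cong (i +_) (sum-mergeLast i′ I j)) (sym (+-assoc i (sum (i′ ∷ I)) j))

positive-mergeLast : ∀ {i I} j → All (1 ≤_) (i ∷ I) → All (1 ≤_) (mergeLast (i ∷ I) j)
positive-mergeLast {i} {[]}     j (pi ∷ _)   = ≤-trans pi (m≤m+n i j) ∷ []
positive-mergeLast {I = _ ∷ _}  j (pi ∷ pos) = pi ∷ positive-mergeLast j pos

homogeneous-ribbonTerms : ∀ {a b} e e′ → IsComposition a (proj₂ e) → IsComposition b (proj₂ e′)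
                        → Homogeneous (a + b) (ribbonTerms e e′)
homogeneous-ribbonTerms     (c , [])    (d , J)     (refl , _) isJ        = isJ ∷ []
homogeneous-ribbonTerms {a} (c , i ∷ I) (d , [])    isI        (refl , _) =
  subst (λ n → IsComposition n (i ∷ I)) (sym (+-identityʳ a)) isI ∷ []
homogeneous-ribbonTerms (c , i ∷ I) (d , j ∷ J) (refl , posI) (refl , posJ@(pj ∷ posJ′)) =
  (sum-++ (i ∷ I) (j ∷ J) , ++⁺ posI posJ) ∷
  (trans (sum-++ (mergeLast (i ∷ I) j) J)
         (trans (cong (_+ sum J) (sum-mergeLast i I j)) (+-assoc (sum (i ∷ I)) j (sum J))) ,
   ++⁺ (positive-mergeLast j posI) posJ′) ∷ []

homogeneous-star : ∀ {a b X Y} → Homogeneous a X → Homogeneous b Y → Homogeneous (a + b) (star X Y)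
homogeneous-star hX hY =
  concat⁺ (map⁺ (All.map (λ {e} isI →
    concat⁺ (map⁺ (All.map (λ {e′} isJ → homogeneous-ribbonTerms e e′ isI isJ) hY))) hX))

homogeneous-conv : ∀ {X Y} → (∀ a → Homogeneous a (X a)) → (∀ b → Homogeneous b (Y b))
                 → ∀ n → Homogeneous n (conv X Y n)
homogeneous-conv {X} {Y} hX hY n = concat⁺ (map⁺ (applyUpTo⁺₁ id (suc n) λ {a} a<1+n →
  subst (λ m → Homogeneous m (star (X a) (Y (n ∸ a)))) (m+[n∸m]≡n (≤-pred a<1+n))
        (homogeneous-star (hX a) (hY (n ∸ a)))))

homogeneous-V1minus : ∀ d → Homogeneous d (V1minus d)
homogeneous-V1minus d = (sum-replicate d , positive-replicate d) ∷ []
  where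
  sum-replicate : ∀ d → sum (replicate d 1) ≡ d
  sum-replicate zero    = refl
  sum-replicate (suc d) = cong suc (sum-replicate d)
  positive-replicate : ∀ d → All (1 ≤_) (replicate d 1)
  positive-replicate zero    = []
  positive-replicate (suc d) = s≤s z≤n ∷ positive-replicate d

homogeneous-V1plus : ∀ d → Homogeneous d (V1plus d)
homogeneous-V1plus zero    = (refl , []) ∷ []
homogeneous-V1plus (suc d) = (+-identityʳ (suc d) , s≤s z≤n ∷ []) ∷ []

V2 : Graded
V2 = conv V1minus V1plus

homogeneous-V2 : ∀ d → Homogeneous d (V2 d)
homogeneous-V2 = homogeneous-conv homogeneous-V1minus homogeneous-V1plus

homogeneous-Vpow : ∀ k n → Homogeneous n (Vpow k n)
homogeneous-Vpow zero    zero    = (refl , []) ∷ []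
homogeneous-Vpow zero    (suc n) = []
homogeneous-Vpow (suc k)         = homogeneous-conv homogeneous-V2 (homogeneous-Vpow k)

-- Compositions of d ≥ 1 are described by words of length d − 1.
coeffG : Graded → List Bool → ℚ
coeffG X u = coeff (X (suc (length u))) u

-- cutSum f g g₀ u = Σ_{u = v ++ x ∷ w} f v · g w  +  f u · g₀
cutSum : (List Bool → ℚ) → (List Bool → ℚ) → ℚ → List Bool → ℚ
cutSum f g g₀ []      = f [] Q.* g₀
cutSum f g g₀ (x ∷ u) = f [] Q.* g u Q.+ cutSum (λ v → f (x ∷ v)) g g₀ u

cutSum-cong : ∀ {f f′ g g′} g₀ u → (∀ v → f v ≡ f′ v) → (∀ w → g w ≡ g′ w) → cutSum f g g₀ u ≡ cutSum f′ g′ g₀ u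
cutSum-cong g₀ []      f≗ g≗ = cong (Q._* g₀) (f≗ [])
cutSum-cong g₀ (x ∷ u) f≗ g≗ = cong₂ Q._+_ (cong₂ Q._*_ (f≗ []) (g≗ u)) (cutSum-cong g₀ u (λ v → f≗ (x ∷ v)) g≗)

cutSum-zeroˡ : ∀ {f} g g₀ u → (∀ v → f v ≡ 0ℚ) → cutSum f g g₀ u ≡ 0ℚ
cutSum-zeroˡ g g₀ []      f≡0 = trans (cong (Q._* g₀) (f≡0 [])) (Q.*-zeroˡ g₀)
cutSum-zeroˡ g g₀ (x ∷ u) f≡0 =
  trans (cong₂ (λ a b → a Q.* g u Q.+ b) (f≡0 []) (cutSum-zeroˡ g g₀ u (λ v → f≡0 (x ∷ v))))
        (trans (Q.+-identityʳ _) (Q.*-zeroˡ (g u)))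

∑-applyUpTo-cutSum : ∀ u (F : ℕ → ℚ) h f g g₀
                   → (∀ v x w → u ≡ v ++ x ∷ w → F (h (length v)) ≡ f v Q.* g w)
                   → F (h (length u)) ≡ f u Q.* g₀
                   → ∑ F (applyUpTo h (suc (length u))) ≡ cutSum f g g₀ u
∑-applyUpTo-cutSum []      F h f g g₀ cut last = trans (Q.+-identityʳ _) last
∑-applyUpTo-cutSum (x ∷ u) F h f g g₀ cut last =
  cong₂ Q._+_ (cut [] x u refl)
              (∑-applyUpTo-cutSum u F (λ a → h (suc a)) (λ v → f (x ∷ v)) g g₀
                                  (λ v y w eq → cut (x ∷ v) y w (cong (x ∷_) eq)) last)

module _ {X Y : Graded} (hX : ∀ a → Homogeneous a (X a)) (hY : ∀ b → Homogeneous b (Y b)) where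

  private
    cut : ∀ u v x w → u ≡ v ++ x ∷ w
        → coeff (star (X (suc (length v))) (Y (length u ∸ length v))) u ≡ coeffG X v Q.* coeffG Y w
    cut .(v ++ x ∷ w) v x w refl
      rewrite length-++ v {x ∷ w} | m+n∸m≡n (length v) (suc (length w)) =
      coeff-star-split (X (suc (length v))) (Y (suc (length w))) v x w (hX _) (hY _)

    last : ∀ u → coeff (star (X (suc (length u))) (Y (length u ∸ length u))) u ≡ coeffG X u Q.* coeff (Y 0) []
    last u rewrite n∸n≡0 (length u) = coeff-star-unitʳ (X (suc (length u))) (Y 0) u (hY 0)

  coeff-conv : ∀ u → coeffG (conv X Y) u
                   ≡ coeff (X 0) [] Q.* coeffG Y u Q.+ cutSum (coeffG X) (coeffG Y) (coeff (Y 0) []) u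
  coeff-conv u =
    trans (coeff-concatMap G (upTo (suc (suc (length u)))) u)
          (cong₂ Q._+_ (coeff-star-unitˡ (X 0) (Y (suc (length u))) u (hX 0))
                       (∑-applyUpTo-cutSum u (λ a → coeff (G a) u) suc (coeffG X) (coeffG Y) (coeff (Y 0) [])
                                            (cut u) (last u)))
    where
    G : ℕ → FSum
    G a = star (X a) (Y (suc (length u) ∸ a))

private
  ribbonWord-ones : ∀ n → ribbonWord (replicate (suc n) 1) ≡ replicate n true
  ribbonWord-ones zero    = refl
  ribbonWord-ones (suc n) = cong (true ∷_) (ribbonWord-ones n)

  wordEq-trues : ∀ v → wordEq v (replicate (length v) true) ≡ and v
  wordEq-trues []          = refl
  wordEq-trues (true ∷ v)  = wordEq-trues v
  wordEq-trues (false ∷ v) = refl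

  wordEq-falses : ∀ v → wordEq v (replicate (length v) false) ≡ all not v
  wordEq-falses []          = refl
  wordEq-falses (true ∷ v)  = refl
  wordEq-falses (false ∷ v) = wordEq-falses v

coeffG-V1minus : ∀ v → coeffG V1minus v ≡ select (and v) 1ℚ
coeffG-V1minus v rewrite ribbonWord-ones (length v) | wordEq-trues v = Q.+-identityʳ _

coeffG-V1plus : ∀ v → coeffG V1plus v ≡ select (all not v) 1ℚ
coeffG-V1plus v rewrite wordEq-falses v = Q.+-identityʳ _

peaklessWeight : List Bool → ℚ
peaklessWeight u = select (peakCount u ≡ᵇ 0) two

-- The peakless words are trueᵃ falseᵇ, and each arises in exactly two ways as a ribbon of R_(1ᵃ′) ⋆ R_(b′).
coeffG-V2 : ∀ u → coeffG V2 u ≡ peaklessWeight u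
coeffG-V2 u =
  trans (coeff-conv homogeneous-V1minus homogeneous-V1plus u)
        (trans (cong₂ (λ a b → 1ℚ Q.* a Q.+ b) (coeffG-V1plus u) (cutSum-cong 1ℚ u coeffG-V1minus coeffG-V1plus))
               (hooks u))
  where
  onlyAscents : List Bool → ℚ
  onlyAscents w = select (all not w) 1ℚ
  peakless-false∷ : ∀ w → (peakCount (false ∷ w) ≡ᵇ 0) ≡ all not w
  peakless-false∷ []          = refl
  peakless-false∷ (true ∷ w)  = refl
  peakless-false∷ (false ∷ w) = peakless-false∷ w
  hooks : ∀ u → 1ℚ Q.* onlyAscents u Q.+ cutSum (λ v → select (and v) 1ℚ) onlyAscents 1ℚ u ≡ peaklessWeight u
  hooks []          = refl
  hooks (true ∷ w)  =
    trans (Q.+-identityˡ _) (trans (hooks w) (cong (λ p → select (p ≡ᵇ 0) two) (sym (peakCount-true∷ w))))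
  hooks (false ∷ w)
    rewrite cutSum-zeroˡ {λ v → select (and (false ∷ v)) 1ℚ} onlyAscents 1ℚ w (λ _ → refl) | peakless-false∷ w
    with all not w
  ... | true  = refl
  ... | false = refl

cutSum-peakless : ∀ s u → cutSum peaklessWeight s 1ℚ u ≡ increment s u
cutSum-peakless s []                  = refl
cutSum-peakless s (false ∷ [])        = refl
cutSum-peakless s (true ∷ w)          =
  cong (two Q.* s w Q.+_)
       (trans (cutSum-cong 1ℚ w (λ v → cong (λ p → select (p ≡ᵇ 0) two) (peakCount-true∷ v)) (λ _ → refl))
              (cutSum-peakless s w))
cutSum-peakless s (false ∷ true ∷ w)  =
  cong (λ x → two Q.* s (true ∷ w) Q.+ x)
       (trans (cong (two Q.* s w Q.+_) (cutSum-zeroˡ s 1ℚ w (λ _ → refl))) (Q.+-identityʳ (two Q.* s w)))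
cutSum-peakless s (false ∷ false ∷ w) = cong (two Q.* s (false ∷ w) Q.+_) (cutSum-peakless s (false ∷ w))

coeff-Vpow-zero : ∀ k → coeff (Vpow k 0) [] ≡ 1ℚ
coeff-Vpow-zero zero    = refl
coeff-Vpow-zero (suc k) =
  trans (∑-++ (coeffOf []) (star (V2 0) (Vpow k 0)) [])
        (trans (Q.+-identityʳ _)
               (trans (coeff-star-unitˡ (V2 0) (Vpow k 0) [] (homogeneous-V2 0))
                      (cong (1ℚ Q.*_) (coeff-Vpow-zero k))))

coeffG-Vpow : ∀ k u → coeffG (Vpow k) u ≡ coeffV k u
coeffG-Vpow zero    u = refl
coeffG-Vpow (suc k) u = begin
  coeffG (Vpow (suc k)) u
    ≡⟨ coeff-conv homogeneous-V2 (homogeneous-Vpow k) u ⟩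
  1ℚ Q.* coeffG (Vpow k) u Q.+ cutSum (coeffG V2) (coeffG (Vpow k)) (coeff (Vpow k 0) []) u
    ≡⟨ cong₂ Q._+_ (trans (Q.*-identityˡ _) (coeffG-Vpow k u))
                   (trans (cong (λ c → cutSum (coeffG V2) (coeffG (Vpow k)) c u) (coeff-Vpow-zero k))
                          (cutSum-cong 1ℚ u coeffG-V2 (coeffG-Vpow k))) ⟩
  coeffV k u Q.+ cutSum peaklessWeight (coeffV k) 1ℚ u
    ≡⟨ cong (coeffV k u Q.+_) (cutSum-peakless (coeffV k) u) ⟩
  coeffV (suc k) u ∎
  where
  open ≡-Reasoning

descentWord : ∀ {n} → Permutation′ n → List Bool
descentWord {n} σ = map (isDes σ) (range 1 (n ∸ 1))

length-range : ∀ a m → length (range a m) ≡ m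
length-range a zero    = refl
length-range a (suc m) = cong suc (length-range (suc a) m)

length-descentWord : ∀ {n} (σ : Permutation′ n) → length (descentWord σ) ≡ n ∸ 1
length-descentWord {n} σ = trans (length-map (isDes σ) (range 1 (n ∸ 1))) (length-range 1 (n ∸ 1))

range-bounds : ∀ a m → All (λ i → a ≤ i × i < a + m) (range a m)
range-bounds a zero    = []
range-bounds a (suc m) =
  (≤-refl , m<m+n a (s≤s z≤n))
  ∷ All.map (λ {i} (lo , hi) → ≤-trans (n≤1+n a) lo , subst (i <_) (sym (+-suc a m)) hi) (range-bounds (suc a) m)

descsFrom-lower : ∀ acc i I → All (acc + i ≤_) (descsFrom acc (i ∷ I))
descsFrom-lower acc i []       = []
descsFrom-lower acc i (j ∷ J)  = ≤-refl ∷ All.map (≤-trans (m≤m+n (acc + i) j)) (descsFrom-lower (acc + i) j J)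

descsFrom-upper : ∀ acc I → All (1 ≤_) I → All (_< acc + sum I) (descsFrom acc I)
descsFrom-upper acc []          _                 = []
descsFrom-upper acc (i ∷ [])    _                 = []
descsFrom-upper acc (i ∷ j ∷ J) (_ ∷ pos@(pj ∷ _)) =
  +-monoʳ-< acc (m<m+n i (≤-trans pj (m≤m+n j (sum J))))
  ∷ All.map (λ {d} d< → subst (d <_) (+-assoc acc i (sum (j ∷ J))) d<) (descsFrom-upper (acc + i) (j ∷ J) pos)

descsFrom-shift : ∀ acc i I → descsFrom acc (suc i ∷ I) ≡ descsFrom (suc acc) (i ∷ I)
descsFrom-shift acc i []      = refl
descsFrom-shift acc i (j ∷ J) = cong (λ a → a ∷ descsFrom a (j ∷ J)) (+-suc acc i)

≢⇒≡ᵇ≡false : ∀ {m n} → m ≢ n → (m ≡ᵇ n) ≡ false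
≢⇒≡ᵇ≡false {zero}  {zero}  m≢n = ⊥-elim (m≢n refl)
≢⇒≡ᵇ≡false {zero}  {suc n} _   = refl
≢⇒≡ᵇ≡false {suc m} {zero}  _   = refl
≢⇒≡ᵇ≡false {suc m} {suc n} m≢n = ≢⇒≡ᵇ≡false (m≢n ∘ cong suc)

≡ᵇ-refl : ∀ n → (n ≡ᵇ n) ≡ true
≡ᵇ-refl zero    = refl
≡ᵇ-refl (suc n) = ≡ᵇ-refl n

<⇒<ᵇ≡true : ∀ {m n} → m < n → (m <ᵇ n) ≡ true
<⇒<ᵇ≡true m<n = T-≡ .Equivalence.to (<⇒<ᵇ m<n)

memb-false : ∀ {x D} → All (x <_) D → memb x D ≡ false
memb-false []           = refl
memb-false (x<d ∷ x<D) = cong₂ _∨_ (≢⇒≡ᵇ≡false (≢-sym (<⇒≢ x<d))) (memb-false x<D)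

private
  map-false-range : ∀ a m → map (λ _ → false) (range a m) ≡ replicate m false
  map-false-range a zero    = refl
  map-false-range a (suc m) = cong (false ∷_) (map-false-range (suc a) m)

descentIndicator : ∀ acc i I → All (1 ≤_) (i ∷ I)
                 → map (λ x → memb x (descsFrom acc (i ∷ I))) (range (suc acc) (sum (i ∷ I) ∸ 1))
                   ≡ ribbonWord (i ∷ I)
descentIndicator acc i             []      _ =
  trans (map-false-range (suc acc) (i + 0 ∸ 1)) (cong (λ m → replicate (m ∸ 1) false) (+-identityʳ i))
descentIndicator acc (suc zero)    (suc j ∷ J) (_ ∷ pos) rewrite +-comm acc 1 | ≡ᵇ-refl acc =
  cong (true ∷_) (trans (map-cong-local (All.map later (range-bounds (suc (suc acc)) (j + sum J))))
                        (descentIndicator (suc acc) (suc j) J pos))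
  where
  later : ∀ {x} → suc (suc acc) ≤ x × x < suc (suc acc) + (j + sum J)
        → (suc acc ≡ᵇ x) ∨ memb x (descsFrom (suc acc) (suc j ∷ J)) ≡ memb x (descsFrom (suc acc) (suc j ∷ J))
  later {x} (acc+2≤x , _) = cong (_∨ memb x (descsFrom (suc acc) (suc j ∷ J))) (≢⇒≡ᵇ≡false (<⇒≢ acc+2≤x))
descentIndicator acc (suc zero)    (zero ∷ J) (_ ∷ () ∷ _)
descentIndicator acc (suc (suc i)) (j ∷ J) (_ ∷ pos) =
  cong₂ _∷_ (memb-false (All.map (<-≤-trans suc-acc<) (descsFrom-lower acc (suc (suc i)) (j ∷ J))))
            (trans (map-cong (λ x → cong (memb x) (descsFrom-shift acc (suc i) (j ∷ J)))
                             (range (suc (suc acc)) (i + sum (j ∷ J))))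
                   (descentIndicator (suc acc) (suc i) (j ∷ J) (s≤s z≤n ∷ pos)))
  where
  suc-acc< : suc acc < acc + suc (suc i)
  suc-acc< = subst (suc (suc acc) ≤_) (sym (trans (+-suc acc (suc i)) (cong suc (+-suc acc i))))
                   (s≤s (s≤s (m≤m+n acc i)))

private
  allB-boolEq : ∀ (f g : ℕ → Bool) L → allB (λ i → boolEq (f i) (g i)) L ≡ wordEq (map f L) (map g L)
  allB-boolEq f g []      = refl
  allB-boolEq f g (x ∷ L) = cong (boolEq (f x) (g x) ∧_) (allB-boolEq f g L)

  allB-All : ∀ {P : ℕ → Set} {f : ℕ → Bool} {L} → All P L → (∀ {d} → P d → f d ≡ true) → allB f L ≡ true
  allB-All []       _  = refl
  allB-All (p ∷ ps) ok = cong₂ _∧_ (ok p) (allB-All ps ok)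

sameDes-descentWord : ∀ {n} (σ : Permutation′ n) I → IsComposition n I
                    → sameDes σ I ≡ wordEq (descentWord σ) (ribbonWord I)
sameDes-descentWord σ []      (refl , _)   = refl
sameDes-descentWord σ (i ∷ I) (refl , pos@(pi ∷ _)) =
  trans (cong₂ _∧_ (allB-boolEq (isDes σ) (λ x → memb x (compDes (i ∷ I))) (range 1 (sum (i ∷ I) ∸ 1)))
                   (allB-All (All.zip (descsFrom-lower 0 i I , descsFrom-upper 0 (i ∷ I) pos))
                             (λ (lo , hi) → cong₂ _∧_ (<⇒<ᵇ≡true (≤-trans pi lo)) (<⇒<ᵇ≡true hi))))
        (trans (∧-identityʳ _) (cong (wordEq (descentWord σ)) (descentIndicator 0 i I pos)))

ι-coeff : ∀ {n} (σ : Permutation′ n) X → Homogeneous n X → ι n X σ ≡ coeff X (descentWord σ)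
ι-coeff σ []            []           = refl
ι-coeff σ ((c , I) ∷ X) (isI ∷ hX) =
  cong₂ Q._+_ (cong (λ b → if b then c else 0ℚ) (sameDes-descentWord σ I isI)) (ι-coeff σ X hX)

val-fromℕ< : ∀ {n} (σ : Permutation′ n) {p} (p<n : p < n) → val σ (suc p) ≡ toℕ (σ ⟨$⟩ʳ fromℕ< p<n)
val-fromℕ< {n} σ {p} p<n with p <? n
... | yes _   = refl
... | no  p≮n = ⊥-elim (p≮n p<n)

val-injective : ∀ {n} (σ : Permutation′ n) {p q} → p < n → q < n → val σ (suc p) ≡ val σ (suc q) → p ≡ q
val-injective σ {p} {q} p<n q<n eq =
  trans (sym (toℕ-fromℕ< p<n)) (trans (cong toℕ fromℕ<-eq) (toℕ-fromℕ< q<n))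
  where
  σ-eq : σ ⟨$⟩ʳ fromℕ< p<n ≡ σ ⟨$⟩ʳ fromℕ< q<n
  σ-eq = toℕ-injective (trans (sym (val-fromℕ< σ p<n)) (trans eq (val-fromℕ< σ q<n)))
  fromℕ<-eq : fromℕ< p<n ≡ fromℕ< q<n
  fromℕ<-eq = trans (sym (inverseˡ σ)) (trans (cong (σ ⟨$⟩ˡ_) σ-eq) (inverseˡ σ))

<ᵇ-flip : ∀ {a b} → a ≢ b → (a <ᵇ b) ≡ not (b <ᵇ a)
<ᵇ-flip {zero}  {zero}  a≢b = ⊥-elim (a≢b refl)
<ᵇ-flip {zero}  {suc b} _   = refl
<ᵇ-flip {suc a} {zero}  _   = refl
<ᵇ-flip {suc a} {suc b} a≢b = <ᵇ-flip (λ eq → a≢b (cong suc eq))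

count-peakCount : ∀ {p d : ℕ → Bool} a m → All (λ i → p i ≡ not (d (i ∸ 1)) ∧ d i) (range (suc (suc a)) m)
                → count p (range (suc (suc a)) m) ≡ peakCount (map d (range (suc a) (suc m)))
count-peakCount     a zero    []       = refl
count-peakCount {p} {d} a (suc m) (eq ∷ eqs) rewrite eq =
  cong (λ k → if not (d (suc a)) ∧ d (suc (suc a)) then suc k else k) (count-peakCount (suc a) m eqs)

peaks-descentWord : ∀ {n} (σ : Permutation′ n) → 2 ≤ n → peaks σ ≡ peakCount (descentWord σ)
peaks-descentWord {suc zero}    σ (s≤s ())
peaks-descentWord {suc (suc n)} σ _ = count-peakCount 0 n (All.map peak≡ (range-bounds 2 n))
  where
  peak≡ : ∀ {i} → 2 ≤ i × i < 2 + n → isPeak σ i ≡ not (isDes σ (i ∸ 1)) ∧ isDes σ i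
  peak≡ {suc zero}    (s≤s () , _)
  peak≡ {suc (suc j)} (_ , j+2<n) =
    cong (_∧ isDes σ (suc (suc j)))
         (<ᵇ-flip (λ eq → <⇒≢ (n<1+n j) (val-injective σ (<-trans (n<1+n j) j+1<n) j+1<n eq)))
    where j+1<n = <-trans (n<1+n (suc j)) j+2<n

-- A permutation with a prescribed number of peaks

swapPairs : ℕ → ℕ → ℕ
swapPairs zero    i             = i
swapPairs (suc l) zero          = 1
swapPairs (suc l) (suc zero)    = 0
swapPairs (suc l) (suc (suc i)) = suc (suc (swapPairs l i))

swapPairs-involutive : ∀ l i → swapPairs l (swapPairs l i) ≡ i
swapPairs-involutive zero    i             = refl
swapPairs-involutive (suc l) zero          = refl
swapPairs-involutive (suc l) (suc zero)    = refl
swapPairs-involutive (suc l) (suc (suc i)) = cong (λ j → suc (suc j)) (swapPairs-involutive l i)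

private
  double-pred : ∀ {l m} → suc l + suc l ≤ suc (suc m) → l + l ≤ m
  double-pred {l} {m} h = ≤-pred (≤-pred (subst (_≤ suc (suc m)) (cong suc (+-suc l l)) h))

  double-≰1 : ∀ {l} → suc l + suc l ≤ 1 → ⊥
  double-≰1 {l} (s≤s h) with subst (_≤ 0) (+-suc l l) h
  ... | ()

swapPairs-< : ∀ l {i m} → i < m → l + l ≤ m → swapPairs l i < m
swapPairs-< zero                    i<m _ = i<m
swapPairs-< (suc l) {m = suc zero}    _  2l≤m = ⊥-elim (double-≰1 2l≤m)
swapPairs-< (suc l) {zero}        {suc (suc m)} _ _ = s≤s (s≤s z≤n)
swapPairs-< (suc l) {suc zero}        i<m _ = <-trans (s≤s z≤n) i<m
swapPairs-< (suc l) {suc (suc i)} {suc (suc m)} (s≤s (s≤s i<m)) 2l≤m =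
  s≤s (s≤s (swapPairs-< l i<m (double-pred 2l≤m)))

-- The values 0, 2, 1, 4, 3, …, 2l, 2l − 1, 2l + 1, 2l + 2, … have their peaks exactly at the positions 2, 4, …, 2l.
zigzagPerm : ℕ → ℕ → ℕ
zigzagPerm l zero    = 0
zigzagPerm l (suc i) = suc (swapPairs l i)

zigzagPerm-involutive : ∀ l i → zigzagPerm l (zigzagPerm l i) ≡ i
zigzagPerm-involutive l zero    = refl
zigzagPerm-involutive l (suc i) = cong suc (swapPairs-involutive l i)

zigzagPerm-< : ∀ l {i n} → i < n → l + l < n → zigzagPerm l i < n
zigzagPerm-< l {zero}  i<n _               = i<n
zigzagPerm-< l {suc i} (s≤s i<n) (s≤s 2l≤n) = s≤s (swapPairs-< l i<n 2l≤n)

zigzagDescent : ℕ → ℕ → Bool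
zigzagDescent l i = zigzagPerm l i <ᵇ zigzagPerm l (i ∸ 1)

private
  zigzagDescent-shift : ∀ l i → 1 ≤ i → zigzagDescent (suc l) (suc (suc i)) ≡ zigzagDescent l i
  zigzagDescent-shift l (suc zero)    _ = refl
  zigzagDescent-shift l (suc (suc i)) _ = refl

  zigzagDescent-zero : ∀ i → zigzagDescent 0 (suc i) ≡ false
  zigzagDescent-zero zero    = refl
  zigzagDescent-zero (suc i) = 1+n<ᵇn i
    where
    1+n<ᵇn : ∀ n → (suc n <ᵇ n) ≡ false
    1+n<ᵇn zero    = refl
    1+n<ᵇn (suc n) = 1+n<ᵇn n

  map-range-shift : ∀ {A : Set} (g : ℕ → A) a m
                  → map g (range (suc (suc a)) m) ≡ map (λ i → g (suc (suc i))) (range a m)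
  map-range-shift g a zero    = refl
  map-range-shift g a (suc m) = cong (g (suc (suc a)) ∷_) (map-range-shift g (suc a) m)

  peakCount-falses : ∀ m → peakCount (replicate m false) ≡ 0
  peakCount-falses zero          = refl
  peakCount-falses (suc zero)    = refl
  peakCount-falses (suc (suc m)) = peakCount-falses (suc m)

peakCount-zigzagDescent : ∀ l m → l + l ≤ m → peakCount (map (zigzagDescent l) (range 1 m)) ≡ l
peakCount-zigzagDescent zero    m _ =
  trans (cong peakCount (trans (map-cong-local (All.map (λ { {suc i} _ → zigzagDescent-zero i }) (range-bounds 1 m)))
                               (map-false-range 1 m)))
        (peakCount-falses m)
peakCount-zigzagDescent (suc l) zero          ()
peakCount-zigzagDescent (suc l) (suc zero)    2l≤1 = ⊥-elim (double-≰1 2l≤1)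
peakCount-zigzagDescent (suc l) (suc (suc m)) 2l≤m =
  cong suc (trans (peakCount-true∷ (map (zigzagDescent (suc l)) (range 3 m)))
                  (trans (cong peakCount (trans (map-range-shift (zigzagDescent (suc l)) 1 m)
                                                (map-cong-local (All.map (λ (1≤i , _) → zigzagDescent-shift l _ 1≤i)
                                                                         (range-bounds 1 m)))))
                         (peakCount-zigzagDescent l m (double-pred 2l≤m))))

module _ (n l : ℕ) (2l<n : l + l < n) where

  private
    zigzagFin : Fin n → Fin n
    zigzagFin i = fromℕ< (zigzagPerm-< l (toℕ<n i) 2l<n)

    toℕ-zigzagFin : ∀ i → toℕ (zigzagFin i) ≡ zigzagPerm l (toℕ i)
    toℕ-zigzagFin i = toℕ-fromℕ< (zigzagPerm-< l (toℕ<n i) 2l<n)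

    zigzagFin-involutive : ∀ i → zigzagFin (zigzagFin i) ≡ i
    zigzagFin-involutive i =
      toℕ-injective (trans (toℕ-zigzagFin (zigzagFin i))
                           (trans (cong (zigzagPerm l) (toℕ-zigzagFin i)) (zigzagPerm-involutive l (toℕ i))))

  zigzagPermutation : Permutation′ n
  zigzagPermutation = permutation zigzagFin zigzagFin zigzagFin-involutive zigzagFin-involutive

  val-zigzagPermutation : ∀ {p} → p < n → val zigzagPermutation (suc p) ≡ zigzagPerm l p
  val-zigzagPermutation p<n =
    trans (val-fromℕ< zigzagPermutation p<n) (trans (toℕ-zigzagFin (fromℕ< p<n)) (cong (zigzagPerm l) (toℕ-fromℕ< p<n)))

permutation-with-peaks : ∀ n l → 2 ≤ n → l + l < n → Σ (Permutation′ n) λ σ → peaks σ ≡ l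
permutation-with-peaks (suc n) l 2≤n 2l<n =
  σ , trans (peaks-descentWord σ 2≤n)
            (trans (cong peakCount (map-cong-local (All.map descent≡ (range-bounds 1 n))))
                   (peakCount-zigzagDescent l n (≤-pred 2l<n)))
  where
  σ = zigzagPermutation (suc n) l 2l<n
  descent≡ : ∀ {i} → 1 ≤ i × i < 1 + n → isDes σ i ≡ zigzagDescent l i
  descent≡ {suc i} (_ , i+1<n) =
    cong₂ _<ᵇ_ (val-zigzagPermutation (suc n) l 2l<n i+1<n)
               (val-zigzagPermutation (suc n) l 2l<n (<-trans (n<1+n i) i+1<n))

-- Triangular systems

sumTo-cong : ∀ M {f g : ℕ → ℚ} → (∀ j → j < M → f j ≡ g j) → sumTo M f ≡ sumTo M g
sumTo-cong zero    eq = refl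
sumTo-cong (suc M) eq = cong₂ Q._+_ (sumTo-cong M (λ j j<M → eq j (m<n⇒m<1+n j<M))) (eq M ≤-refl)

sumTo-zero : ∀ M {f : ℕ → ℚ} → (∀ j → j < M → f j ≡ 0ℚ) → sumTo M f ≡ 0ℚ
sumTo-zero zero    _   = refl
sumTo-zero (suc M) f≡0 = cong₂ Q._+_ (sumTo-zero M (λ j j<M → f≡0 j (m<n⇒m<1+n j<M))) (f≡0 M ≤-refl)

sumTo-truncate : ∀ {K} M {f : ℕ → ℚ} → K ≤ M → (∀ l → K ≤ l → f l ≡ 0ℚ) → sumTo M f ≡ sumTo K f
sumTo-truncate zero    z≤n    _   = refl
sumTo-truncate (suc M) K≤1+M f≡0 with m≤n⇒m<n∨m≡n K≤1+M
... | inj₂ refl  = refl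
... | inj₁ K<1+M =
  trans (cong₂ Q._+_ (sumTo-truncate M (≤-pred K<1+M) f≡0) (f≡0 M (≤-pred K<1+M))) (Q.+-identityʳ _)

indicator : ℕ → ℕ → ℚ
indicator p l = if p ≡ᵇ l then 1ℚ else 0ℚ

sumTo-indicator : ∀ M (a : ℕ → ℚ) p → p < M → sumTo M (λ l → a l Q.* indicator p l) ≡ a p
sumTo-indicator M a p p<M = begin
  sumTo M (λ l → a l Q.* indicator p l)
    ≡⟨ sumTo-truncate M p<M (λ l p<l → off (λ p≡l → <⇒≢ p<l p≡l)) ⟩
  sumTo p (λ l → a l Q.* indicator p l) Q.+ a p Q.* indicator p p
    ≡⟨ cong₂ Q._+_ (sumTo-zero p (λ l l<p → off (λ p≡l → <⇒≢ l<p (sym p≡l))))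
                   (cong (λ b → a p Q.* (if b then 1ℚ else 0ℚ)) (≡ᵇ-refl p)) ⟩
  0ℚ Q.+ a p Q.* 1ℚ
    ≡⟨ trans (Q.+-identityˡ _) (Q.*-identityʳ (a p)) ⟩
  a p ∎
  where
  open ≡-Reasoning
  off : ∀ {l} → p ≢ l → a l Q.* indicator p l ≡ 0ℚ
  off {l} p≢l = trans (cong (λ b → a l Q.* (if b then 1ℚ else 0ℚ)) (≢⇒≡ᵇ≡false p≢l)) (Q.*-zeroʳ (a l))

module Triangular (B : ℕ → ℕ → ℚ) (M : ℕ) (d⁻¹ : ℕ → ℚ)
                  (diagonal : ∀ p → p < M → d⁻¹ p Q.* B p p ≡ 1ℚ)
                  (lower : ∀ j p → j < p → p < M → B j p ≡ 0ℚ) where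

  private
    below-diagonal : ∀ K (c : ℕ → ℚ) → K < M → sumTo K (λ j → c j Q.* B j K) ≡ 0ℚ
    below-diagonal K c K<M = sumTo-zero K (λ j j<K → trans (cong (c j Q.*_) (lower j K j<K K<M)) (Q.*-zeroʳ (c j)))

  triangular-solve : ∀ K (a : ℕ → ℚ) → K ≤ M → Σ (ℕ → ℚ) λ c → ∀ p → p < K → sumTo K (λ j → c j Q.* B j p) ≡ a p
  triangular-solve zero    a _     = (λ _ → 0ℚ) , λ _ ()
  triangular-solve (suc K) a K<M = c , solves
    where
    cK = d⁻¹ K Q.* a K
    rest = triangular-solve K (λ p → a p Q.- cK Q.* B K p) (<⇒≤ K<M)
    c : ℕ → ℚ
    c j = if j ≡ᵇ K then cK else proj₁ rest j
    c≡rest : ∀ j → j < K → c j ≡ proj₁ rest j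
    c≡rest j j<K = cong (λ b → if b then cK else proj₁ rest j) (≢⇒≡ᵇ≡false (<⇒≢ j<K))
    cK≡ : c K ≡ cK
    cK≡ = cong (λ b → if b then cK else proj₁ rest K) (≡ᵇ-refl K)
    lower-part : ∀ p → sumTo K (λ j → c j Q.* B j p) ≡ sumTo K (λ j → proj₁ rest j Q.* B j p)
    lower-part p = sumTo-cong K (λ j j<K → cong (Q._* B j p) (c≡rest j j<K))
    solves : ∀ p → p < suc K → sumTo (suc K) (λ j → c j Q.* B j p) ≡ a p
    solves p p<1+K with m≤n⇒m<n∨m≡n (≤-pred p<1+K)
    ... | inj₁ p<K rewrite lower-part p | proj₂ rest p p<K | cK≡ =
      solve 2 (λ x y → (x :- y) :+ y := x) refl (a p) (cK Q.* B K p)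
    ... | inj₂ refl rewrite lower-part K | below-diagonal K (proj₁ rest) K<M | cK≡ =
      trans (Q.+-identityˡ _)
            (trans (solve 3 (λ i x b → (i :* x) :* b := (i :* b) :* x) refl (d⁻¹ K) (a K) (B K K))
                   (trans (cong (Q._* a K) (diagonal K K<M)) (Q.*-identityˡ (a K))))

  private
    top-coefficient-zero : ∀ K (c : ℕ → ℚ) → K < M → sumTo (suc K) (λ j → c j Q.* B j K) ≡ 0ℚ → c K ≡ 0ℚ
    top-coefficient-zero K c K<M sum≡0 = begin
      c K                        ≡⟨ sym (Q.*-identityʳ (c K)) ⟩
      c K Q.* 1ℚ                 ≡⟨ cong (c K Q.*_) (sym (diagonal K K<M)) ⟩
      c K Q.* (d⁻¹ K Q.* B K K)  ≡⟨ solve 3 (λ x i b → x :* (i :* b) := (x :* b) :* i) refl (c K) (d⁻¹ K) (B K K) ⟩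
      (c K Q.* B K K) Q.* d⁻¹ K  ≡⟨ cong (Q._* d⁻¹ K) top≡0 ⟩
      0ℚ Q.* d⁻¹ K               ≡⟨ Q.*-zeroˡ (d⁻¹ K) ⟩
      0ℚ                         ∎
      where
      open ≡-Reasoning
      top≡0 : c K Q.* B K K ≡ 0ℚ
      top≡0 = trans (sym (trans (cong (Q._+ c K Q.* B K K) (below-diagonal K c K<M)) (Q.+-identityˡ _))) sum≡0

  triangular-independent : ∀ K (c : ℕ → ℚ) → K ≤ M → (∀ p → p < K → sumTo K (λ j → c j Q.* B j p) ≡ 0ℚ)
                         → ∀ j → j < K → c j ≡ 0ℚ
  triangular-independent (suc K) c K<M sums≡0 j j<1+K with m≤n⇒m<n∨m≡n (≤-pred j<1+K)
  ... | inj₂ refl = top-coefficient-zero K c K<M (sums≡0 K ≤-refl)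
  ... | inj₁ j<K  = triangular-independent K c (<⇒≤ K<M) lower-sums≡0 j j<K
    where
    cK≡0 = top-coefficient-zero K c K<M (sums≡0 K ≤-refl)
    lower-sums≡0 : ∀ p → p < K → sumTo K (λ j → c j Q.* B j p) ≡ 0ℚ
    lower-sums≡0 p p<K = begin
      sumTo K (λ j → c j Q.* B j p)         ≡⟨ sym (Q.+-identityʳ _) ⟩
      sumTo K (λ j → c j Q.* B j p) Q.+ 0ℚ  ≡⟨ cong (sumTo K (λ j → c j Q.* B j p) Q.+_)
                                                   (sym (trans (cong (Q._* B K p) cK≡0) (Q.*-zeroˡ (B K p)))) ⟩
      sumTo (suc K) (λ j → c j Q.* B j p)   ≡⟨ sums≡0 p (m<n⇒m<1+n p<K) ⟩
      0ℚ                                    ∎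
      where
      open ≡-Reasoning

≤⌊/2⌋⇒+≤ : ∀ {p m} → p ≤ ⌊ m /2⌋ → p + p ≤ m
≤⌊/2⌋⇒+≤ {p} {m} p≤ =
  ≤-trans (+-mono-≤ p≤ (≤-trans p≤ (⌊n/2⌋≤⌈n/2⌉ m))) (≤-reflexive (⌊n/2⌋+⌈n/2⌉≡n m))

+≤⇒≤⌊/2⌋ : ∀ {p m} → p + p ≤ m → p ≤ ⌊ m /2⌋
+≤⇒≤⌊/2⌋ {p} p+p≤m = subst (_≤ _) (sym (n≡⌊n+n/2⌋ p)) (⌊n/2⌋-mono p+p≤m)

half^ : ℕ → ℚ
half^ zero    = 1ℚ
half^ (suc e) = ½ Q.* half^ e

half^*pow2 : ∀ e → half^ e Q.* pow2 e ≡ 1ℚ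
half^*pow2 zero    = refl
half^*pow2 (suc e) =
  trans (solve 4 (λ h t x y → (h :* x) :* (t :* y) := (h :* t) :* (x :* y)) refl ½ two (half^ e) (pow2 e))
        (cong (½ Q.* two Q.*_) (half^*pow2 e))

module _ {m : ℕ} where

  ι-Vminus : ∀ k (σ : Permutation′ (suc m)) → ι (suc m) (Vminus k (suc m)) σ ≡ coeffV k (descentWord σ)
  ι-Vminus k σ =
    trans (ι-coeff σ (Vpow k (suc m)) (homogeneous-Vpow k (suc m)))
          (trans (cong (λ d → coeff (Vpow k (suc d)) (descentWord σ)) (sym (length-descentWord σ)))
                 (coeffG-Vpow k (descentWord σ)))

  peakProfile : ℕ → ℕ → ℚ
  peakProfile k p = coeffV k (normalWord (m ∸ (p + p)) p)

  peakProfile-vanishes : ∀ k l → k ≤ l → peakProfile k l ≡ 0ℚ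
  peakProfile-vanishes k l k≤l =
    coeffV-vanishes k (normalWord (m ∸ (l + l)) l) (subst (k ≤_) (sym (peakCount-normalWord (m ∸ (l + l)) l)) k≤l)

  peakProfile-leading : ∀ k → peakProfile (suc k) k ≡ pow2 (suc (k + k))
  peakProfile-leading k = coeffV-leading k (normalWord (m ∸ (k + k)) k) (peakCount-normalWord (m ∸ (k + k)) k)

  module _ (2≤1+m : 2 ≤ suc m) where

    peaks-bound : ∀ (σ : Permutation′ (suc m)) → peaks σ + peaks σ ≤ m
    peaks-bound σ rewrite peaks-descentWord σ 2≤1+m =
      subst (peakCount (descentWord σ) + peakCount (descentWord σ) ≤_) (length-descentWord σ)
            (peakCount+peakCount≤length (descentWord σ))

    ι-Vminus-peakProfile : ∀ k (σ : Permutation′ (suc m)) → ι (suc m) (Vminus k (suc m)) σ ≡ peakProfile k (peaks σ)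
    ι-Vminus-peakProfile k σ =
      trans (ι-Vminus k σ)
            (coeffV-invariant k (descentWord σ) (normalWord (m ∸ (p + p)) p)
              (trans (length-descentWord σ) (sym (trans (length-normalWord (m ∸ (p + p)) p) (m∸n+n≡m (peaks-bound σ)))))
              (trans (sym (peaks-descentWord σ 2≤1+m)) (sym (peakCount-normalWord (m ∸ (p + p)) p))))
      where
      p = peaks σ

    Vminus-in-peak-algebra : ∀ k (σ : Permutation′ (suc m))
      → ι (suc m) (Vminus k (suc m)) σ ≡ sumTo (suc ⌊ m /2⌋) (λ l → peakProfile k l Q.* Ppk (suc m) l σ)
    Vminus-in-peak-algebra k σ =
      trans (ι-Vminus-peakProfile k σ)
            (sym (sumTo-indicator (suc ⌊ m /2⌋) (peakProfile k) (peaks σ) (s≤s (+≤⇒≤⌊/2⌋ (peaks-bound σ)))))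

    Vminus-leading : ∀ k → 2 * suc k ≤ suc m + 1 → ∀ σ →
      ι (suc m) (Vminus (suc k) (suc m)) σ
        ≡ pow2 (2 * suc k ∸ 1) Q.* Ppk (suc m) k σ Q.+ sumTo k (λ l → peakProfile (suc k) l Q.* Ppk (suc m) l σ)
    Vminus-leading k 2k≤m+1 σ = begin
      ι (suc m) (Vminus (suc k) (suc m)) σ
        ≡⟨ Vminus-in-peak-algebra (suc k) σ ⟩
      sumTo (suc ⌊ m /2⌋) term
        ≡⟨ sumTo-truncate (suc ⌊ m /2⌋) (s≤s (+≤⇒≤⌊/2⌋ (halve 2k≤m+1)))
                          (λ l k<l → trans (cong (Q._* Ppk (suc m) l σ) (peakProfile-vanishes (suc k) l k<l))
                                           (Q.*-zeroˡ (Ppk (suc m) l σ))) ⟩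
      sumTo k term Q.+ peakProfile (suc k) k Q.* Ppk (suc m) k σ
        ≡⟨ Q.+-comm (sumTo k term) _ ⟩
      peakProfile (suc k) k Q.* Ppk (suc m) k σ Q.+ sumTo k term
        ≡⟨ cong (λ c → c Q.* Ppk (suc m) k σ Q.+ sumTo k term)
                (trans (peakProfile-leading k) (cong pow2 (exponent k))) ⟩
      pow2 (2 * suc k ∸ 1) Q.* Ppk (suc m) k σ Q.+ sumTo k term ∎
      where
      open ≡-Reasoning
      term : ℕ → ℚ
      term l = peakProfile (suc k) l Q.* Ppk (suc m) l σ
      exponent : ∀ k → suc (k + k) ≡ k + suc (k + 0)
      exponent = solve-∀
      double-suc : ∀ k → 2 * suc k ≡ suc (suc (k + k))
      double-suc = solve-∀
      halve : 2 * suc k ≤ suc m + 1 → k + k ≤ m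
      halve le = ≤-pred (≤-pred (subst₂ _≤_ (double-suc k) (+-comm (suc m) 1) le))

    private
      diagonalInverse : ℕ → ℚ
      diagonalInverse p = half^ (suc (p + p))

      peakProfile-diagonal : ∀ p → p < suc ⌊ m /2⌋ → diagonalInverse p Q.* peakProfile (suc p) p ≡ 1ℚ
      peakProfile-diagonal p _ =
        trans (cong (diagonalInverse p Q.*_) (peakProfile-leading p)) (half^*pow2 (suc (p + p)))

      peakProfile-lower : ∀ j p → j < p → p < suc ⌊ m /2⌋ → peakProfile (suc j) p ≡ 0ℚ
      peakProfile-lower j p j<p _ = peakProfile-vanishes (suc j) p j<p

    open Triangular (peakProfile ∘ suc) (suc ⌊ m /2⌋) diagonalInverse peakProfile-diagonal peakProfile-lower

    Vminus-combination : ∀ (c : ℕ → ℚ) σ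
      → sumTo (suc ⌊ m /2⌋) (λ j → c j Q.* ι (suc m) (Vminus (suc j) (suc m)) σ)
        ≡ sumTo (suc ⌊ m /2⌋) (λ j → c j Q.* peakProfile (suc j) (peaks σ))
    Vminus-combination c σ = sumTo-cong (suc ⌊ m /2⌋) (λ j _ → cong (c j Q.*_) (ι-Vminus-peakProfile (suc j) σ))

    Vminus-spanning : (f : QS (suc m)) → InPeakAlg (suc m) f → Σ (ℕ → ℚ) λ c →
      ∀ σ → f σ ≡ sumTo (suc ⌊ m /2⌋) (λ j → c j Q.* ι (suc m) (Vminus (suc j) (suc m)) σ)
    Vminus-spanning f (a , f≡) = c , λ σ →
      trans (f≡ σ) (trans (sumTo-indicator (suc ⌊ m /2⌋) a (peaks σ) (peaks<M σ))
                          (sym (trans (Vminus-combination c σ) (solves (peaks σ) (peaks<M σ)))))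
      where
      peaks<M : ∀ σ → peaks σ < suc ⌊ m /2⌋
      peaks<M σ = s≤s (+≤⇒≤⌊/2⌋ (peaks-bound σ))
      c = proj₁ (triangular-solve (suc ⌊ m /2⌋) a ≤-refl)
      solves = proj₂ (triangular-solve (suc ⌊ m /2⌋) a ≤-refl)

    Vminus-independent : (c : ℕ → ℚ)
      → (∀ σ → sumTo (suc ⌊ m /2⌋) (λ j → c j Q.* ι (suc m) (Vminus (suc j) (suc m)) σ) ≡ 0ℚ)
      → ∀ j → j < suc ⌊ m /2⌋ → c j ≡ 0ℚ
    Vminus-independent c combination≡0 = triangular-independent (suc ⌊ m /2⌋) c ≤-refl λ p p<M →
      let (σ , peaks≡p) = permutation-with-peaks (suc m) p 2≤1+m (s≤s (≤⌊/2⌋⇒+≤ (≤-pred p<M)))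
      in trans (cong (λ q → sumTo (suc ⌊ m /2⌋) (λ j → c j Q.* peakProfile (suc j) q)) (sym peaks≡p))
               (trans (sym (Vminus-combination c σ)) (combination≡0 σ))

proposition4p2 : (n : ℕ) → 2 ≤ n →
    ((k : ℕ) → 1 ≤ k → InPeakAlg n (ι n (Vminus k n)))
    × ((k : ℕ) → 1 ≤ k → 2 * k ≤ n + 1 →
        Σ (ℕ → ℚ) λ a → ∀ σ →
          ι n (Vminus k n) σ
            ≡ pow2 (2 * k ∸ 1) Q.* Ppk n (k ∸ 1) σ
              Q.+ sumTo (k ∸ 1) (λ l → a l Q.* Ppk n l σ))
    × IsPeakBasis n
proposition4p2 (suc m) 2≤n =
    (λ k _ → peakProfile k , Vminus-in-peak-algebra 2≤n k)
  , (λ { (suc k) _ 2k≤n+1 → peakProfile (suc k) , Vminus-leading 2≤n k 2k≤n+1 })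
  , (Vminus-spanning 2≤n , Vminus-independent 2≤n)
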